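{- Let $\Sigma$ be a totally ordered alphabet, let $\$\notin\Sigma$ be a symbol smaller than every symbol of $\Sigma$, and let $T=T[0]\cdots T[n-1]$ be a string with $T[0,n-2]\in\Sigma^+$ and $T[n-1]=\$$. For $0\le k\le n-1$ write $T_k=T[k,n-1]$. Fix $s$ with $0\le s\le n-3$, and index the suffixes $T_{s+1},\dots,T_{n-1}$ by the positions $s+1,\dots,n-1$ in increasing lexicographic order: the position of $T_k$ is $s+1$ plus the number of suffixes in $\{T_{s+1},\dots,T_{n-1}\}$ lexicographically smaller than $T_k$. Let $p$ be the position of $T_{s+1}$. Let $r=s+|\{k\in\{s+1,\dots,n-1\}: T_k<T_s\}|$, so that $r$ is the position that $T_s$ occupies in the lexicographic order of $T_s,T_{s+1},\dots,T_{n-1}$ when these are indexed by the positions $s,s+1,\dots,n-1$. Suppose $r+1\le n-1$, and let $T_b$, with $b\in\{s+1,\dots,n-1\}$, be the suffix whose position is $r+1$ (in the indexing of $T_{s+1},\dots,T_{n-1}$ by positions $s+1,\dots,n-1$). Suppose $b\le n-2$, and let $p_{b+1}$ be the position of $T_{b+1}$ in that same indexing. If $p_{b+1}\notin(p,n-1]$, then $T[s]\neq T[b]$.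
   Context: The array $B$ with $B[\text{position of }T_k]=T[k-1]$ for $s+2\le k\le n-1$ and $B[p]=\$$ is the Burrows–Wheeler transform of $T_{s+1}$ stored in positions $s+1,\dots,n-1$; in particular the symbol stored at position $p_{b+1}$ is $T[b]$, so the conclusion says that this stored symbol differs from $T[s]$. Lexicographic order $<$ on strings is the one induced by the order of $\Sigma\cup\{\$\}$. -}

module Defs where

open import Level using (Level; _⊔_)
open import Data.Nat using (ℕ; suc; _+_; _∸_)
open import Data.List using (List; []; _∷_; map; _++_; drop; length; filter; upTo; head)
open import Data.Maybe using (Maybe; nothing; just)
import Data.Maybe.Properties as MP
open import Relation.Binary using (Rel; Decidable; IsStrictTotalOrder)
open import Relation.Binary.PropositionalEquality using (_≡_; refl; cong)
open import Relation.Nullary using (yes; no)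
open import Data.List.Relation.Binary.Lex.Strict using (Lex-<; <-decidable)

module Alphabet {a ℓ : Level} {A : Set a} {_≺_ : Rel A ℓ}
                (sto : IsStrictTotalOrder _≡_ _≺_) where

  open IsStrictTotalOrder sto using () renaming (_≟_ to _≟A_; _<?_ to _≺?_)

  -- Σ ∪ {$}: nothing plays the role of $, just x is the letter x ∈ Σ.
  Sym : Set a
  Sym = Maybe A

  $ : Sym
  $ = nothing

  data _<ₛ_ : Sym → Sym → Set (a ⊔ ℓ) where
    $<  : ∀ {y} → nothing <ₛ just y
    j<  : ∀ {x y} → x ≺ y → just x <ₛ just y

  _<ₛ?_ : Decidable _<ₛ_
  nothing <ₛ? nothing = no (λ ())
  nothing <ₛ? just y  = yes $<
  just x  <ₛ? nothing = no (λ ())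
  just x  <ₛ? just y with x ≺? y
  ... | yes p = yes (j< p)
  ... | no ¬p = no (λ { (j< q) → ¬p q })

  _≟ₛ_ : Decidable {A = Sym} _≡_
  _≟ₛ_ = MP.≡-dec _≟A_

  _<lex_ : Rel (List Sym) (a ⊔ ℓ)
  _<lex_ = Lex-< _≡_ _<ₛ_

  _<lex?_ : Decidable _<lex_
  _<lex?_ = <-decidable _≟ₛ_ _<ₛ?_

  -- The text T = w $ (so T[0,n-2] = w, T[n-1] = $, n = |w| + 1).
  text : List A → List Sym
  text w = map just w ++ ($ ∷ [])

  suf : List Sym → ℕ → List Sym
  suf T k = drop k T

  -- The symbol T[k] (defined, i.e. `just`, whenever k < n).
  charAt : List Sym → ℕ → Maybe Sym
  charAt T k = head (drop k T)

  range : ℕ → ℕ → List ℕ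
  range i j = map (i +_) (upTo (j ∸ i))

  smallerThan : List Sym → ℕ → List Sym → ℕ
  smallerThan T s X = length (filter (λ k' → suf T k' <lex? X) (range (suc s) (length T)))

  pos : List Sym → ℕ → ℕ → ℕ
  pos T s k = suc s + smallerThan T s (suf T k)

  rk : List Sym → ℕ → ℕ
  rk T s = s + smallerThan T s (suf T s)

-- If T[s] = T[b], then T_s and T_b are compared by their tails T_{s+1} and
-- T_{b+1}. The hypothesis on the position of T_b says that exactly as many
-- suffixes of T_{s+1} are below T_b as below T_s; since T_b itself is below
-- T_s whenever T_b < T_s, this forces T_s < T_b, hence T_{s+1} < T_{b+1},
-- hence p < p_{b+1} ≤ n-1, contradicting p_{b+1} ∉ (p, n-1].
module Submission where

open import Defs
open import Level using (Level)
open import Data.Nat using (ℕ; zero; suc; _+_; _∸_; _≤_; _<_; s≤s; z≤n)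
open import Data.Nat.Properties
  using (≤-refl; ≤-trans; <-trans; <⇒≤; <⇒≢; >⇒≢; n<1+n; n≤1+n; m≤n+m; m≤n⇒m≤1+n; suc-injective;
         +-comm; +-cancelˡ-≡; +-monoʳ-≤; +-monoʳ-<; ∸-monoˡ-<; ∸-monoʳ-<; m+[n∸m]≡n; m≤o∸n⇒m+n≤o;
         suc[m]≤n⇒m≤pred[n]; module ≤-Reasoning)
open import Data.List using (List; []; _∷_; length; filter; drop; map; upTo; head)
open import Data.List.Properties using (length-drop; length-map; length-upTo; filter-notAll)
open import Data.List.Membership.Propositional using (_∈_; lose)
open import Data.List.Membership.Propositional.Properties using (∈-map⁺; ∈-upTo⁺)
open import Data.List.Relation.Unary.Any using (here; there)
open import Data.List.Relation.Binary.Lex.Strict using (<-isStrictTotalOrder)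
open import Data.List.Relation.Binary.Lex using (toSum)
import Data.List.Relation.Binary.Pointwise as Pointwise
open import Data.Maybe using (just; nothing)
import Data.Maybe.Properties as Maybe
open import Data.Product using (_×_; _,_; ∃-syntax)
open import Data.Sum using (inj₁; inj₂)
open import Relation.Binary using (Rel; IsStrictTotalOrder; tri<; tri≈; tri>)
open import Relation.Binary.PropositionalEquality
  using (_≡_; _≢_; refl; sym; trans; cong; subst; subst₂; isEquivalence)
open import Function using (_∘_)
open import Relation.Nullary using (¬_; yes; no; contradiction)
open import Relation.Unary using (Pred; Decidable; _⊆_)

private
  variable
    a p q : Level
    A : Set a

length-filter-mono : {P : Pred A p} {Q : Pred A q} (P? : Decidable P) (Q? : Decidable Q) →
                     P ⊆ Q → ∀ xs → length (filter P? xs) ≤ length (filter Q? xs)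
length-filter-mono P? Q? P⊆Q [] = z≤n
length-filter-mono P? Q? P⊆Q (x ∷ xs) with ih ← length-filter-mono P? Q? P⊆Q xs | P? x | Q? x
... | yes px | yes _  = s≤s ih
... | yes px | no ¬qx = contradiction (P⊆Q px) ¬qx
... | no _   | yes _  = m≤n⇒m≤1+n ih
... | no _   | no _   = ih

length-filter-strictMono : {P : Pred A p} {Q : Pred A q} (P? : Decidable P) (Q? : Decidable Q) →
                           P ⊆ Q → ∀ {x} xs → x ∈ xs → ¬ P x → Q x →
                           length (filter P? xs) < length (filter Q? xs)
length-filter-strictMono P? Q? P⊆Q (x ∷ xs) (here refl) ¬px qx with P? x | Q? x
... | yes px | _      = contradiction px ¬px
... | no _   | yes _  = s≤s (length-filter-mono P? Q? P⊆Q xs)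
... | no _   | no ¬qx = contradiction qx ¬qx
length-filter-strictMono P? Q? P⊆Q (y ∷ xs) (there x∈xs) ¬px qx
  with ih ← length-filter-strictMono P? Q? P⊆Q xs x∈xs ¬px qx | P? y | Q? y
... | yes _  | yes _  = s≤s ih
... | yes py | no ¬qy = contradiction (P⊆Q py) ¬qy
... | no _   | yes _  = m≤n⇒m≤1+n ih
... | no _   | no _   = ih

head-drop-just : ∀ k (xs : List A) → k < length xs → ∃[ c ] head (drop k xs) ≡ just c
head-drop-just zero    (x ∷ xs) _       = x , refl
head-drop-just (suc k) (x ∷ xs) (s≤s k<n) = head-drop-just k xs k<n

drop-head∷drop-suc : ∀ k (xs : List A) {c} → head (drop k xs) ≡ just c → drop k xs ≡ c ∷ drop (suc k) xs
drop-head∷drop-suc zero    (x ∷ xs) refl = refl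
drop-head∷drop-suc (suc k) (x ∷ xs) eq   = drop-head∷drop-suc k xs eq

drop-strictMono-length : ∀ {j k} (xs : List A) → j < k → k ≤ length xs → length (drop k xs) < length (drop j xs)
drop-strictMono-length {j = j} {k} xs j<k k≤n
  rewrite length-drop j xs | length-drop k xs = ∸-monoʳ-< j<k k≤n

module Suffixes {a ℓ} {A : Set a} {_≺_ : Rel A ℓ} (sto : IsStrictTotalOrder _≡_ _≺_) where
  open Alphabet sto
  open IsStrictTotalOrder sto using () renaming (trans to ≺-trans; irrefl to ≺-irrefl; compare to ≺-compare)

  <ₛ-isStrictTotalOrder : IsStrictTotalOrder _≡_ _<ₛ_
  <ₛ-isStrictTotalOrder = record
    { isStrictPartialOrder = record
      { isEquivalence = isEquivalence
      ; irrefl        = λ { refl (j< x≺x) → ≺-irrefl refl x≺x }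
      ; trans         = λ { $< (j< _) → $< ; (j< x≺y) (j< y≺z) → j< (≺-trans x≺y y≺z) }
      ; <-resp-≈      = (λ { refl lt → lt }) , (λ { refl lt → lt })
      }
    ; compare = compare
    }
    where
    compare : ∀ x y → _
    compare nothing  nothing  = tri≈ (λ ()) refl (λ ())
    compare nothing  (just y) = tri< $< (λ ()) (λ ())
    compare (just x) nothing  = tri> (λ ()) (λ ()) $<
    compare (just x) (just y) with ≺-compare x y
    ... | tri< x≺y x≢y y⊀x = tri< (j< x≺y) (x≢y ∘ Maybe.just-injective) (λ { (j< y≺x) → y⊀x y≺x })
    ... | tri≈ x⊀y x≡y y⊀x = tri≈ (λ { (j< x≺y) → x⊀y x≺y }) (cong just x≡y) (λ { (j< y≺x) → y⊀x y≺x })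
    ... | tri> x⊀y x≢y y≺x = tri> (λ { (j< x≺y) → x⊀y x≺y }) (x≢y ∘ Maybe.just-injective) (j< y≺x)

  ∈-range : ∀ {i j k} → i ≤ k → k < j → k ∈ range i j
  ∈-range {i} {j} {k} i≤k k<j =
    subst (_∈ range i j) (m+[n∸m]≡n i≤k) (∈-map⁺ (i +_) (∈-upTo⁺ (∸-monoˡ-< k<j i≤k)))

  length-range : ∀ i j → length (range i j) ≡ j ∸ i
  length-range i j = trans (length-map (i +_) (upTo (j ∸ i))) (length-upTo (j ∸ i))

  module Lex = IsStrictTotalOrder (<-isStrictTotalOrder <ₛ-isStrictTotalOrder)

  <lex-irrefl : ∀ xs → ¬ xs <lex xs
  <lex-irrefl xs = Lex.irrefl (Pointwise.refl refl)

  ∷-<lex-cancelˡ : ∀ {c xs ys} → (c ∷ xs) <lex (c ∷ ys) → xs <lex ys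
  ∷-<lex-cancelˡ lt with toSum lt
  ... | inj₁ c<c       = contradiction c<c (IsStrictTotalOrder.irrefl <ₛ-isStrictTotalOrder refl)
  ... | inj₂ (_ , lt′) = lt′

  module _ (T : List Sym) (s : ℕ) {k : ℕ} (s<k : s < k) (k<n : k < length T) where

    smallerThan-strictMono : ∀ {Y} → suf T k <lex Y → smallerThan T s (suf T k) < smallerThan T s Y
    smallerThan-strictMono {Y} Tₖ<Y =
      length-filter-strictMono (λ i → suf T i <lex? suf T k) (λ i → suf T i <lex? Y)
        (λ Tᵢ<Tₖ → Lex.trans Tᵢ<Tₖ Tₖ<Y) (range (suc s) (length T)) (∈-range s<k k<n)
        (<lex-irrefl (suf T k)) Tₖ<Y

    pos-strictMono : ∀ {j} → suf T k <lex suf T j → pos T s k < pos T s j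
    pos-strictMono Tₖ<Tⱼ = +-monoʳ-< (suc s) (smallerThan-strictMono Tₖ<Tⱼ)

    pos≤n∸1 : pos T s k ≤ length T ∸ 1
    pos≤n∸1 = suc[m]≤n⇒m≤pred[n] (begin-strict
      suc s + smallerThan T s (suf T k) <⟨ +-monoʳ-< (suc s) smallerThan<size ⟩
      suc s + (length T ∸ suc s)        ≡⟨ m+[n∸m]≡n (<-trans s<k k<n) ⟩
      length T                          ∎)
      where
      open ≤-Reasoning
      smallerThan<size : smallerThan T s (suf T k) < length T ∸ suc s
      smallerThan<size =
        subst (smallerThan T s (suf T k) <_) (length-range (suc s) (length T))
          (filter-notAll (λ i → suf T i <lex? suf T k) (range (suc s) (length T))
            (lose (∈-range s<k k<n) (<lex-irrefl (suf T k))))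

    ≡-smallerThan⇒<lex : smallerThan T s (suf T k) ≡ smallerThan T s (suf T s) → suf T s <lex suf T k
    ≡-smallerThan⇒<lex same with Lex.compare (suf T s) (suf T k)
    ... | tri< Tₛ<Tₖ _ _ = Tₛ<Tₖ
    ... | tri≈ _ Tₛ≋Tₖ _ = contradiction (cong length (Pointwise.Pointwise-≡⇒≡ Tₛ≋Tₖ))
                             (>⇒≢ (drop-strictMono-length T s<k (<⇒≤ k<n)))
    ... | tri> _ _ Tₖ<Tₛ = contradiction same (<⇒≢ (smallerThan-strictMono Tₖ<Tₛ))

  suf-suc-<lex : ∀ (T : List Sym) {j k} → j < length T → charAt T j ≡ charAt T k →
                 suf T j <lex suf T k → suf T (suc j) <lex suf T (suc k)
  suf-suc-<lex T {j} {k} j<n Tⱼ≡Tₖ Tⱼ<Tₖ with c , Tⱼ≡c ← head-drop-just j T j<n =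
    ∷-<lex-cancelˡ (subst₂ _<lex_ (drop-head∷drop-suc j T Tⱼ≡c)
                      (drop-head∷drop-suc k T (trans (sym Tⱼ≡Tₖ) Tⱼ≡c)) Tⱼ<Tₖ)

lemma2 : ∀ {a ℓ : Level} {A : Set a} {_≺_ : Rel A ℓ}
      (sto : IsStrictTotalOrder _≡_ _≺_) →
      let open Alphabet sto in
      (w : List A) (s b : ℕ) →
      let T = text w
          n = length T
      in s + 3 ≤ n →
         rk T s + 1 ≤ n ∸ 1 →
         suc s ≤ b → b ≤ n ∸ 2 →
         pos T s b ≡ rk T s + 1 →
         ¬ (pos T s (suc s) < pos T s (suc b) × pos T s (suc b) ≤ n ∸ 1) →
         charAt T s ≢ charAt T b
lemma2 sto w s b s+3≤n _ s<b b≤n∸2 pos-b≡r+1 pᵦ₊₁∉ Tₛ≡Tᵦ =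
  pᵦ₊₁∉ (pos-strictMono T s ≤-refl (<-trans (s≤s s<b) b+1<n) {suc b} Tₛ₊₁<Tᵦ₊₁ ,
            pos≤n∸1 T s (s≤s (<⇒≤ s<b)) b+1<n)
  where
  open Alphabet sto
  open Suffixes sto
  T = text w
  b+1<n : suc b < length T
  b+1<n = subst (_≤ length T) (+-comm b 2)
            (m≤o∸n⇒m+n≤o b (≤-trans (m≤n+m 2 s) (≤-trans (+-monoʳ-≤ s (n≤1+n 2)) s+3≤n)) b≤n∸2)
  b<n : b < length T
  b<n = <-trans (n<1+n b) b+1<n
  same-count : smallerThan T s (suf T b) ≡ smallerThan T s (suf T s)
  same-count = +-cancelˡ-≡ s _ _ (suc-injective (trans pos-b≡r+1 (+-comm (rk T s) 1)))
  Tₛ₊₁<Tᵦ₊₁ : suf T (suc s) <lex suf T (suc b)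
  Tₛ₊₁<Tᵦ₊₁ = suf-suc-<lex T (<-trans s<b b<n) Tₛ≡Tᵦ (≡-smallerThan⇒<lex T s s<b b<n same-count)
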